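{- Let $\mathcal{L}$ be a first-order signature and let $X\cup\{S\}$ be a set of $\mathcal{L}$-sequents (in particular $\mathcal{L}$-Henkin sequents). If $X \vdash_{\mathcal{ST}^H} S$, then $X \models_{\mathrm{ST}^H} S$.
   Context: A signature $\mathcal{L}$ consists of relation and function symbols of finite (possibly zero) arity, with at least one relation symbol; formulas are built from atomic formulas with $\neg,\wedge,\vee,\forall,\exists$. $\varphi[x\mapsto t]$ denotes substitution of the term $t$ for the free occurrences of $x$ in $\varphi$, always assumed to be capture-free. Henkin expansion. The immediate Henkin expansion of a signature adds a new constant $\mathsf{w}(\forall x\,\varphi)$ for each universal formula $\forall x\,\varphi$ and a new constant $\mathsf{w}(\exists x\,\varphi)$ for each existential formula $\exists x\,\varphi$ of that signature (also when $\varphi$ has free variables other than $x$). With $\mathcal{L}_0=\mathcal{L}$ and $\mathcal{L}_{i+1}$ the immediate Henkin expansion of $\mathcal{L}_i$, let $\mathrm{Hen}\,\mathcal{L}=\bigcup_{i}\mathcal{L}_i$; its terms and formulas are called $\mathcal{L}$-Henkin terms and formulas. An $\mathcal{L}$-(Henkin) sequent $\Gamma\vartriangleright\Delta$ is an ordered pair of finite sets of $\mathcal{L}$-(Henkin) formulas; $\varphi,\Gamma$ means $\{\varphi\}\cup\Gamma$. Semantics. An ST-model for a signature is $\langle D,I\rangle$ with $D\neq\emptyset$, $I(P)\colon D^n\to\{0,\tfrac12,1\}$ for $n$-ary relation symbols, $I(f)\colon D^n\to D$ for function symbols, $I(x)\in D$ for variables; terms evaluated as usual; atomic formulas $I(P(t_1,\dots,t_n))=I(P)(I(t_1),\dots,I(t_n))$;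 $I(\neg\varphi)=1-I(\varphi)$, $I(\varphi\wedge\psi)=\min$, $I(\varphi\vee\psi)=\max$; $I(\forall x\,\varphi)$ (resp. $I(\exists x\,\varphi)$) is the minimum (resp. maximum) of $I'(\varphi)$ over all $x$-variants $I'$ of $I$. A model ST-satisfies $\Gamma\vartriangleright\Delta$ if some $\gamma\in\Gamma$ has value in $\{0,\tfrac12\}$ or some $\delta\in\Delta$ has value in $\{\tfrac12,1\}$. A Henkin expansion of an ST-model $\langle D,I\rangle$ for $\mathcal{L}$ is an ST-model $\langle D,I^H\rangle$ for $\mathrm{Hen}\,\mathcal{L}$ with $I^H(\varphi)=I(\varphi)$ for every $\mathcal{L}$-formula $\varphi$ and, for every $\mathcal{L}$-Henkin formula $\psi$ and variable $x$, $I^H(\psi[x\mapsto\mathsf{w}(\forall x\,\psi)])=I^H(\forall x\,\psi)$ and $I^H(\psi[x\mapsto\mathsf{w}(\exists x\,\psi)])=I^H(\exists x\,\psi)$. An $\mathcal{L}$-Henkin model is a Henkin expansion of some ST-model for $\mathcal{L}$. $X\models_{\mathrm{ST}^H}S$ means: every $\mathcal{L}$-Henkin model that ST-satisfies all members of $X$ ST-satisfies $S$. The calculus $\mathcal{ST}^H$ (on $\mathcal{L}$-Henkin sequents; $t$ ranges over $\mathcal{L}$-Henkin terms): axiom (ID) $\varphi\vartriangleright\varphi$; (WL) from $\Gamma\vartriangleright\Delta$ infer $\varphi,\Gamma\vartriangleright\Delta$; (WR) from $\Gamma\vartriangleright\Delta$ infer $\Gamma\vartriangleright\Delta,\varphi$.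 Bidirectional rules, usable top-down (premises to conclusion) and bottom-up (conclusion to any one premise), written premises / conclusion: ($\wedge$L) $\varphi,\psi,\Gamma\vartriangleright\Delta$ / $\varphi\wedge\psi,\Gamma\vartriangleright\Delta$; ($\wedge$R) $\Gamma\vartriangleright\Delta,\varphi$ and $\Gamma\vartriangleright\Delta,\psi$ / $\Gamma\vartriangleright\Delta,\varphi\wedge\psi$; ($\vee$L) $\varphi,\Gamma\vartriangleright\Delta$ and $\psi,\Gamma\vartriangleright\Delta$ / $\varphi\vee\psi,\Gamma\vartriangleright\Delta$; ($\vee$R) $\Gamma\vartriangleright\Delta,\varphi,\psi$ / $\Gamma\vartriangleright\Delta,\varphi\vee\psi$; ($\neg$R) $\varphi,\Gamma\vartriangleright\Delta$ / $\Gamma\vartriangleright\Delta,\neg\varphi$; ($\neg$L) $\Gamma\vartriangleright\Delta,\varphi$ / $\neg\varphi,\Gamma\vartriangleright\Delta$; ($\forall$LW) $\varphi[x\mapsto\mathsf{w}(\forall x\,\varphi)],\Gamma\vartriangleright\Delta$ / $\forall x\,\varphi,\Gamma\vartriangleright\Delta$; ($\forall$RW) $\Gamma\vartriangleright\Delta,\varphi[x\mapsto\mathsf{w}(\forall x\,\varphi)]$ / $\Gamma\vartriangleright\Delta,\forall x\,\varphi$; ($\exists$LW) $\varphi[x\mapsto\mathsf{w}(\exists x\,\varphi)],\Gamma\vartriangleright\Delta$ / $\exists x\,\varphi,\Gamma\vartriangleright\Delta$; ($\exists$RW) $\Gamma\vartriangleright\Delta,\varphi[x\mapsto\mathsf{w}(\exists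 x\,\varphi)]$ / $\Gamma\vartriangleright\Delta,\exists x\,\varphi$. One-directional rules: (UWI) from $\varphi[x\mapsto t],\Gamma\vartriangleright\Delta$ infer $\varphi[x\mapsto\mathsf{w}(\forall x\,\varphi)],\Gamma\vartriangleright\Delta$; (EWI) from $\Gamma\vartriangleright\Delta,\varphi[x\mapsto t]$ infer $\Gamma\vartriangleright\Delta,\varphi[x\mapsto\mathsf{w}(\exists x\,\varphi)]$; (EWE) from $\varphi[x\mapsto\mathsf{w}(\exists x\,\varphi)],\Gamma\vartriangleright\Delta$ infer $\varphi[x\mapsto t],\Gamma\vartriangleright\Delta$; (UWE) from $\Gamma\vartriangleright\Delta,\varphi[x\mapsto\mathsf{w}(\forall x\,\varphi)]$ infer $\Gamma\vartriangleright\Delta,\varphi[x\mapsto t]$. There is no cut rule and no eigenvariable condition. $X\vdash_{\mathcal{ST}^H}S$ means there is a finite derivation tree ending in $S$ whose leaves are instances of (ID) or members of $X$. -}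

module Defs where

open import Data.Nat using (ℕ; zero; suc; _≤_)
open import Data.Nat.Properties using (_≟_)
open import Data.Bool using (Bool; true; false; _∨_; not; T)
open import Data.Vec using (Vec; []; _∷_)
open import Data.List using (List; []; _∷_)
open import Data.List.Relation.Unary.Any using (Any)
open import Data.List.Relation.Unary.All using (All)
open import Data.List.Membership.Propositional using (_∈_)
open import Data.Product using (Σ; _×_; _,_)
open import Data.Sum using (_⊎_)
open import Data.Empty using (⊥; ⊥-elim)
open import Data.Unit using (⊤)
open import Relation.Nullary using (yes; no)
open import Relation.Binary.PropositionalEquality using (_≡_)

record Signature : Set₁ where
  field
    Rel     : Set
    Fun     : Set
    rarity  : Rel → ℕ
    farity  : Fun → ℕ
    someRel : Rel

data TV : Set where
  𝟘 ½ 𝟙 : TV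

rank : TV → ℕ
rank 𝟘 = 0
rank ½ = 1
rank 𝟙 = 2

_≤ᵥ_ : TV → TV → Set
a ≤ᵥ b = rank a ≤ rank b

neg : TV → TV
neg 𝟘 = 𝟙
neg ½ = ½
neg 𝟙 = 𝟘

minᵥ : TV → TV → TV
minᵥ 𝟘 _ = 𝟘
minᵥ ½ 𝟘 = 𝟘
minᵥ ½ _ = ½
minᵥ 𝟙 b = b

maxᵥ : TV → TV → TV
maxᵥ 𝟘 b = b
maxᵥ ½ 𝟙 = 𝟙
maxᵥ ½ _ = ½
maxᵥ 𝟙 _ = 𝟙

Undesignated : TV → Set
Undesignated v = (v ≡ 𝟘) ⊎ (v ≡ ½)

Designated : TV → Set
Designated v = (v ≡ ½) ⊎ (v ≡ 𝟙)

module Sig (L : Signature) where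
  open Signature L

  Var : Set
  Var = ℕ

  data Term (C : Set) : Set where
    var : Var → Term C
    con : C → Term C
    app : (f : Fun) → Vec (Term C) (farity f) → Term C

  data Formula (C : Set) : Set where
    atom : (P : Rel) → Vec (Term C) (rarity P) → Formula C
    ¬'   : Formula C → Formula C
    _∧'_ : Formula C → Formula C → Formula C
    _∨'_ : Formula C → Formula C → Formula C
    ∀'   : Var → Formula C → Formula C
    ∃'   : Var → Formula C → Formula C

  -- Henkin constants: w(∀x φ) and w(∃x φ) for every Henkin formula φ.
  -- Formula Wit is exactly the set of formulas of Hen L.
  data Wit : Set where
    wAll : Var → Formula Wit → Wit
    wEx  : Var → Formula Wit → Wit

  HTerm : Set
  HTerm = Term Wit

  HFormula : Set
  HFormula = Formula Wit

  LFormula : Set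
  LFormula = Formula ⊥

  w∀ : Var → HFormula → HTerm
  w∀ x φ = con (wAll x φ)

  w∃ : Var → HFormula → HTerm
  w∃ x φ = con (wEx x φ)

  mutual
    mapT : {C C' : Set} → (C → C') → Term C → Term C'
    mapT g (var y) = var y
    mapT g (con c) = con (g c)
    mapT g (app f ts) = app f (mapTs g ts)

    mapTs : {C C' : Set} {n : ℕ} → (C → C') → Vec (Term C) n → Vec (Term C') n
    mapTs g [] = []
    mapTs g (t ∷ ts) = mapT g t ∷ mapTs g ts

  mapF : {C C' : Set} → (C → C') → Formula C → Formula C'
  mapF g (atom P ts) = atom P (mapTs g ts)
  mapF g (¬' φ) = ¬' (mapF g φ)
  mapF g (φ ∧' ψ) = mapF g φ ∧' mapF g ψ
  mapF g (φ ∨' ψ) = mapF g φ ∨' mapF g ψ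
  mapF g (∀' y φ) = ∀' y (mapF g φ)
  mapF g (∃' y φ) = ∃' y (mapF g φ)

  embed : LFormula → HFormula
  embed = mapF ⊥-elim

  IsLFormula : HFormula → Set
  IsLFormula φ = Σ LFormula (λ φ₀ → embed φ₀ ≡ φ)

  -- Substitution φ[x ↦ t] of t for the free occurrences of x.
  -- (Constants are closed, so substitution does not enter them.)
  mutual
    substT : {C : Set} → Var → Term C → Term C → Term C
    substT x t (var y) with x ≟ y
    ... | yes _ = t
    ... | no  _ = var y
    substT x t (con c) = con c
    substT x t (app f ts) = app f (substTs x t ts)

    substTs : {C : Set} {n : ℕ} → Var → Term C → Vec (Term C) n → Vec (Term C) n
    substTs x t [] = []
    substTs x t (s ∷ ss) = substT x t s ∷ substTs x t ss

  _[_↦_] : {C : Set} → Formula C → Var → Term C → Formula C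
  atom P ts [ x ↦ t ] = atom P (substTs x t ts)
  ¬' φ [ x ↦ t ] = ¬' (φ [ x ↦ t ])
  (φ ∧' ψ) [ x ↦ t ] = (φ [ x ↦ t ]) ∧' (ψ [ x ↦ t ])
  (φ ∨' ψ) [ x ↦ t ] = (φ [ x ↦ t ]) ∨' (ψ [ x ↦ t ])
  ∀' y φ [ x ↦ t ] with x ≟ y
  ... | yes _ = ∀' y φ
  ... | no  _ = ∀' y (φ [ x ↦ t ])
  ∃' y φ [ x ↦ t ] with x ≟ y
  ... | yes _ = ∃' y φ
  ... | no  _ = ∃' y (φ [ x ↦ t ])

  mutual
    occursT : {C : Set} → Var → Term C → Bool
    occursT x (var y) with x ≟ y
    ... | yes _ = true
    ... | no  _ = false
    occursT x (con c) = false
    occursT x (app f ts) = occursTs x ts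

    occursTs : {C : Set} {n : ℕ} → Var → Vec (Term C) n → Bool
    occursTs x [] = false
    occursTs x (t ∷ ts) = occursT x t ∨ occursTs x ts

  freeIn : {C : Set} → Var → Formula C → Bool
  freeIn x (atom P ts) = occursTs x ts
  freeIn x (¬' φ) = freeIn x φ
  freeIn x (φ ∧' ψ) = freeIn x φ ∨ freeIn x ψ
  freeIn x (φ ∨' ψ) = freeIn x φ ∨ freeIn x ψ
  freeIn x (∀' y φ) with x ≟ y
  ... | yes _ = false
  ... | no  _ = freeIn x φ
  freeIn x (∃' y φ) with x ≟ y
  ... | yes _ = false
  ... | no  _ = freeIn x φ

  FreeFor : {C : Set} → Term C → Var → Formula C → Set
  FreeFor t x (atom P ts) = ⊤
  FreeFor t x (¬' φ) = FreeFor t x φ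
  FreeFor t x (φ ∧' ψ) = FreeFor t x φ × FreeFor t x ψ
  FreeFor t x (φ ∨' ψ) = FreeFor t x φ × FreeFor t x ψ
  FreeFor t x (∀' y φ) with x ≟ y
  ... | yes _ = ⊤
  ... | no  _ = T (not (freeIn x φ)) ⊎ (T (not (occursT y t)) × FreeFor t x φ)
  FreeFor t x (∃' y φ) with x ≟ y
  ... | yes _ = ⊤
  ... | no  _ = T (not (freeIn x φ)) ⊎ (T (not (occursT y t)) × FreeFor t x φ)

  record Structure (C D : Set) : Set where
    field
      relI : (P : Rel) → Vec D (rarity P) → TV
      funI : (f : Fun) → Vec D (farity f) → D
      conI : C → D

  module _ {C D : Set} (M : Structure C D) where
    open Structure M
    mutual
      evalT : (Var → D) → Term C → D
      evalT ρ (var y) = ρ y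
      evalT ρ (con c) = conI c
      evalT ρ (app f ts) = funI f (evalTs ρ ts)

      evalTs : {n : ℕ} → (Var → D) → Vec (Term C) n → Vec D n
      evalTs ρ [] = []
      evalTs ρ (t ∷ ts) = evalT ρ t ∷ evalTs ρ ts

  _[_≔_] : {D : Set} → (Var → D) → Var → D → (Var → D)
  (ρ [ x ≔ d ]) y with x ≟ y
  ... | yes _ = d
  ... | no  _ = ρ y

  -- An ST-interpretation of L plus constants C over domain D:
  -- symbol interpretations, a variable assignment, and the value of every
  -- formula under every assignment, determined by the ST clauses
  -- (the quantifier clauses say: minimum / maximum over all x-variants).
  record Interp (C D : Set) : Set where
    field
      str : Structure C D
      asg : Var → D
      val : (Var → D) → Formula C → TV
      val-atom : ∀ ρ P ts → val ρ (atom P ts) ≡ Structure.relI str P (evalTs str ρ ts)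
      val-¬ : ∀ ρ φ → val ρ (¬' φ) ≡ neg (val ρ φ)
      val-∧ : ∀ ρ φ ψ → val ρ (φ ∧' ψ) ≡ minᵥ (val ρ φ) (val ρ ψ)
      val-∨ : ∀ ρ φ ψ → val ρ (φ ∨' ψ) ≡ maxᵥ (val ρ φ) (val ρ ψ)
      val-∀-lb : ∀ ρ x φ d → val ρ (∀' x φ) ≤ᵥ val (ρ [ x ≔ d ]) φ
      val-∀-at : ∀ ρ x φ → Σ D (λ d → val (ρ [ x ≔ d ]) φ ≡ val ρ (∀' x φ))
      val-∃-ub : ∀ ρ x φ d → val (ρ [ x ≔ d ]) φ ≤ᵥ val ρ (∃' x φ)
      val-∃-at : ∀ ρ x φ → Σ D (λ d → val (ρ [ x ≔ d ]) φ ≡ val ρ (∃' x φ))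

    value : Formula C → TV
    value = val asg

  open Interp public using (value)

  record HenkinModel (D : Set) : Set where
    field
      base  : Interp ⊥ D
      hen   : Interp Wit D
      agree : ∀ (φ : LFormula) → value hen (embed φ) ≡ value base φ
      witAll : ∀ (x : Var) (ψ : HFormula) →
               value hen (ψ [ x ↦ w∀ x ψ ]) ≡ value hen (∀' x ψ)
      witEx  : ∀ (x : Var) (ψ : HFormula) →
               value hen (ψ [ x ↦ w∃ x ψ ]) ≡ value hen (∃' x ψ)

  -- Sequents: pairs of finite sets of Henkin formulas, represented by
  -- lists taken up to having the same elements.

  Sequent : Set
  Sequent = List HFormula × List HFormula

  _≈ˢ_ : List HFormula → List HFormula → Set
  Γ ≈ˢ Γ' = (∀ {φ} → φ ∈ Γ → φ ∈ Γ') × (∀ {φ} → φ ∈ Γ' → φ ∈ Γ)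

  IsLSequent : Sequent → Set
  IsLSequent (Γ , Δ) = All IsLFormula Γ × All IsLFormula Δ

  STSat : {D : Set} → Interp Wit D → Sequent → Set
  STSat I (Γ , Δ) = Any (λ γ → Undesignated (value I γ)) Γ
                  ⊎ Any (λ δ → Designated (value I δ)) Δ

  _⊨STH_ : (Sequent → Set) → Sequent → Set₁
  X ⊨STH S = ∀ (D : Set) → D → (M : HenkinModel D) →
             (∀ s → X s → STSat (HenkinModel.hen M) s) →
             STSat (HenkinModel.hen M) S

  -- The calculus ST^H.  Bidirectional rules appear as a top-down (↓)
  -- constructor and bottom-up (↑) constructors, one per premise.

  data _⊢STH_ (X : Sequent → Set) : Sequent → Set where
    hyp  : ∀ {s} → X s → X ⊢STH s
    ax   : ∀ {φ} → X ⊢STH (φ ∷ [] , φ ∷ [])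
    -- sequents are pairs of sets: lists with the same elements denote
    -- the same sequent
    sets : ∀ {Γ Δ Γ' Δ'} → Γ ≈ˢ Γ' → Δ ≈ˢ Δ' →
           X ⊢STH (Γ , Δ) → X ⊢STH (Γ' , Δ')
    WL   : ∀ {φ Γ Δ} → X ⊢STH (Γ , Δ) → X ⊢STH (φ ∷ Γ , Δ)
    WR   : ∀ {φ Γ Δ} → X ⊢STH (Γ , Δ) → X ⊢STH (Γ , φ ∷ Δ)
    ∧L↓  : ∀ {φ ψ Γ Δ} → X ⊢STH (φ ∷ ψ ∷ Γ , Δ) → X ⊢STH ((φ ∧' ψ) ∷ Γ , Δ)
    ∧L↑  : ∀ {φ ψ Γ Δ} → X ⊢STH ((φ ∧' ψ) ∷ Γ , Δ) → X ⊢STH (φ ∷ ψ ∷ Γ , Δ)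
    ∧R↓  : ∀ {φ ψ Γ Δ} → X ⊢STH (Γ , φ ∷ Δ) → X ⊢STH (Γ , ψ ∷ Δ) →
           X ⊢STH (Γ , (φ ∧' ψ) ∷ Δ)
    ∧R↑₁ : ∀ {φ ψ Γ Δ} → X ⊢STH (Γ , (φ ∧' ψ) ∷ Δ) → X ⊢STH (Γ , φ ∷ Δ)
    ∧R↑₂ : ∀ {φ ψ Γ Δ} → X ⊢STH (Γ , (φ ∧' ψ) ∷ Δ) → X ⊢STH (Γ , ψ ∷ Δ)
    ∨L↓  : ∀ {φ ψ Γ Δ} → X ⊢STH (φ ∷ Γ , Δ) → X ⊢STH (ψ ∷ Γ , Δ) →
           X ⊢STH ((φ ∨' ψ) ∷ Γ , Δ)
    ∨L↑₁ : ∀ {φ ψ Γ Δ} → X ⊢STH ((φ ∨' ψ) ∷ Γ , Δ) → X ⊢STH (φ ∷ Γ , Δ)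
    ∨L↑₂ : ∀ {φ ψ Γ Δ} → X ⊢STH ((φ ∨' ψ) ∷ Γ , Δ) → X ⊢STH (ψ ∷ Γ , Δ)
    ∨R↓  : ∀ {φ ψ Γ Δ} → X ⊢STH (Γ , φ ∷ ψ ∷ Δ) → X ⊢STH (Γ , (φ ∨' ψ) ∷ Δ)
    ∨R↑  : ∀ {φ ψ Γ Δ} → X ⊢STH (Γ , (φ ∨' ψ) ∷ Δ) → X ⊢STH (Γ , φ ∷ ψ ∷ Δ)
    ¬R↓  : ∀ {φ Γ Δ} → X ⊢STH (φ ∷ Γ , Δ) → X ⊢STH (Γ , ¬' φ ∷ Δ)
    ¬R↑  : ∀ {φ Γ Δ} → X ⊢STH (Γ , ¬' φ ∷ Δ) → X ⊢STH (φ ∷ Γ , Δ)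
    ¬L↓  : ∀ {φ Γ Δ} → X ⊢STH (Γ , φ ∷ Δ) → X ⊢STH (¬' φ ∷ Γ , Δ)
    ¬L↑  : ∀ {φ Γ Δ} → X ⊢STH (¬' φ ∷ Γ , Δ) → X ⊢STH (Γ , φ ∷ Δ)
    ∀LW↓ : ∀ {x φ Γ Δ} → X ⊢STH ((φ [ x ↦ w∀ x φ ]) ∷ Γ , Δ) → X ⊢STH (∀' x φ ∷ Γ , Δ)
    ∀LW↑ : ∀ {x φ Γ Δ} → X ⊢STH (∀' x φ ∷ Γ , Δ) → X ⊢STH ((φ [ x ↦ w∀ x φ ]) ∷ Γ , Δ)
    ∀RW↓ : ∀ {x φ Γ Δ} → X ⊢STH (Γ , (φ [ x ↦ w∀ x φ ]) ∷ Δ) → X ⊢STH (Γ , ∀' x φ ∷ Δ)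
    ∀RW↑ : ∀ {x φ Γ Δ} → X ⊢STH (Γ , ∀' x φ ∷ Δ) → X ⊢STH (Γ , (φ [ x ↦ w∀ x φ ]) ∷ Δ)
    ∃LW↓ : ∀ {x φ Γ Δ} → X ⊢STH ((φ [ x ↦ w∃ x φ ]) ∷ Γ , Δ) → X ⊢STH (∃' x φ ∷ Γ , Δ)
    ∃LW↑ : ∀ {x φ Γ Δ} → X ⊢STH (∃' x φ ∷ Γ , Δ) → X ⊢STH ((φ [ x ↦ w∃ x φ ]) ∷ Γ , Δ)
    ∃RW↓ : ∀ {x φ Γ Δ} → X ⊢STH (Γ , (φ [ x ↦ w∃ x φ ]) ∷ Δ) → X ⊢STH (Γ , ∃' x φ ∷ Δ)
    ∃RW↑ : ∀ {x φ Γ Δ} → X ⊢STH (Γ , ∃' x φ ∷ Δ) → X ⊢STH (Γ , (φ [ x ↦ w∃ x φ ]) ∷ Δ)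
    UWI  : ∀ {x φ t Γ Δ} → FreeFor t x φ →
           X ⊢STH ((φ [ x ↦ t ]) ∷ Γ , Δ) → X ⊢STH ((φ [ x ↦ w∀ x φ ]) ∷ Γ , Δ)
    EWI  : ∀ {x φ t Γ Δ} → FreeFor t x φ →
           X ⊢STH (Γ , (φ [ x ↦ t ]) ∷ Δ) → X ⊢STH (Γ , (φ [ x ↦ w∃ x φ ]) ∷ Δ)
    EWE  : ∀ {x φ t Γ Δ} → FreeFor t x φ →
           X ⊢STH ((φ [ x ↦ w∃ x φ ]) ∷ Γ , Δ) → X ⊢STH ((φ [ x ↦ t ]) ∷ Γ , Δ)
    UWE  : ∀ {x φ t Γ Δ} → FreeFor t x φ →
           X ⊢STH (Γ , (φ [ x ↦ w∀ x φ ]) ∷ Δ) → X ⊢STH (Γ , (φ [ x ↦ t ]) ∷ Δ)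

-- Soundness is local: every rule of ST^H preserves ST-satisfaction in each
-- fixed Henkin model.  The propositional rules are invertible because
-- negation swaps "undesignated" and "designated", min is undesignated iff
-- one argument is and designated iff both are, and dually for max.  The
-- W-rules are exactly the witness equations of a Henkin model.  For the
-- instantiation rules, the substitution lemma shows that w(∀x φ) gives φ
-- its least value over all instances and w(∃x φ) its greatest, while the
-- designated values are closed upwards and the undesignated ones downwards.
module Submission where

open import Defs
open import Data.Nat using (s≤s)
open import Data.Nat.Properties using (_≟_)
open import Data.Bool using (false; not; T)
open import Data.Bool.Properties using (T-∨)
open import Data.Vec using (Vec; []; _∷_)
open import Data.List using (List; []; _∷_)
open import Data.List.Relation.Unary.Any using (here; there)
open import Data.List.Relation.Binary.Subset.Propositional.Properties using (Any-resp-⊆)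
open import Data.Product using (_×_; _,_; proj₁; proj₂)
open import Data.Sum using (_⊎_; inj₁; inj₂; [_,_]′; map₁; map₂; assocʳ; assocˡ)
import Data.Sum as Sum
open import Data.Empty using (⊥-elim)
open import Function using (_∘_; id)
open import Function.Bundles using (_⇔_; mk⇔; Equivalence)
open import Relation.Nullary using (¬_; yes; no)
open import Relation.Binary.PropositionalEquality

open Equivalence using (to; from)

≤ᵥ-antisym : ∀ {a b} → a ≤ᵥ b → b ≤ᵥ a → a ≡ b
≤ᵥ-antisym {𝟘} {𝟘} _ _ = refl
≤ᵥ-antisym {𝟘} {½} _ ()
≤ᵥ-antisym {𝟘} {𝟙} _ ()
≤ᵥ-antisym {½} {𝟘} () _
≤ᵥ-antisym {½} {½} _ _ = refl
≤ᵥ-antisym {½} {𝟙} _ (s≤s ())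
≤ᵥ-antisym {𝟙} {𝟘} () _
≤ᵥ-antisym {𝟙} {½} (s≤s ()) _
≤ᵥ-antisym {𝟙} {𝟙} _ _ = refl

undesignated⊎designated : ∀ a → Undesignated a ⊎ Designated a
undesignated⊎designated 𝟘 = inj₁ (inj₁ refl)
undesignated⊎designated ½ = inj₁ (inj₂ refl)
undesignated⊎designated 𝟙 = inj₂ (inj₂ refl)

¬designated-𝟘 : ¬ Designated 𝟘
¬designated-𝟘 (inj₁ ())
¬designated-𝟘 (inj₂ ())

¬undesignated-𝟙 : ¬ Undesignated 𝟙
¬undesignated-𝟙 (inj₁ ())
¬undesignated-𝟙 (inj₂ ())

designated-mono : ∀ {a b} → a ≤ᵥ b → Designated a → Designated b
designated-mono {𝟘} _ d = ⊥-elim (¬designated-𝟘 d)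
designated-mono {½} {𝟘} () _
designated-mono {½} {½} _ d = d
designated-mono {½} {𝟙} _ _ = inj₂ refl
designated-mono {𝟙} {𝟘} () _
designated-mono {𝟙} {½} (s≤s ()) _
designated-mono {𝟙} {𝟙} _ d = d

undesignated-antimono : ∀ {a b} → a ≤ᵥ b → Undesignated b → Undesignated a
undesignated-antimono {𝟘} _ _ = inj₁ refl
undesignated-antimono {½} _ _ = inj₂ refl
undesignated-antimono {𝟙} {𝟘} () _
undesignated-antimono {𝟙} {½} (s≤s ()) _
undesignated-antimono {𝟙} {𝟙} _ u = u

undesignated-neg : ∀ {a} → Undesignated (neg a) ⇔ Designated a
undesignated-neg {𝟘} = mk⇔ (⊥-elim ∘ ¬undesignated-𝟙) (⊥-elim ∘ ¬designated-𝟘)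
undesignated-neg {½} = mk⇔ (λ _ → inj₁ refl) (λ _ → inj₂ refl)
undesignated-neg {𝟙} = mk⇔ (λ _ → inj₂ refl) (λ _ → inj₁ refl)

designated-neg : ∀ {a} → Designated (neg a) ⇔ Undesignated a
designated-neg {𝟘} = mk⇔ (λ _ → inj₁ refl) (λ _ → inj₂ refl)
designated-neg {½} = mk⇔ (λ _ → inj₂ refl) (λ _ → inj₁ refl)
designated-neg {𝟙} = mk⇔ (⊥-elim ∘ ¬designated-𝟘) (⊥-elim ∘ ¬undesignated-𝟙)

undesignated-min : ∀ {a b} → Undesignated (minᵥ a b) ⇔ (Undesignated a ⊎ Undesignated b)
undesignated-min {𝟘}     = mk⇔ (λ _ → inj₁ (inj₁ refl)) (λ _ → inj₁ refl)
undesignated-min {½} {𝟘} = mk⇔ (λ _ → inj₁ (inj₂ refl)) (λ _ → inj₁ refl)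
undesignated-min {½} {½} = mk⇔ (λ _ → inj₁ (inj₂ refl)) (λ _ → inj₂ refl)
undesignated-min {½} {𝟙} = mk⇔ (λ _ → inj₁ (inj₂ refl)) (λ _ → inj₂ refl)
undesignated-min {𝟙}     = mk⇔ inj₂ [ ⊥-elim ∘ ¬undesignated-𝟙 , id ]′

designated-min : ∀ {a b} → Designated (minᵥ a b) ⇔ (Designated a × Designated b)
designated-min {𝟘}     = mk⇔ (⊥-elim ∘ ¬designated-𝟘)
                              (⊥-elim ∘ ¬designated-𝟘 ∘ proj₁)
designated-min {½} {𝟘} = mk⇔ (⊥-elim ∘ ¬designated-𝟘)
                              (⊥-elim ∘ ¬designated-𝟘 ∘ proj₂)
designated-min {½} {½} = mk⇔ (λ d → d , d) proj₁
designated-min {½} {𝟙} = mk⇔ (λ _ → inj₁ refl , inj₂ refl) (λ _ → inj₁ refl)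
designated-min {𝟙}     = mk⇔ (λ d → inj₂ refl , d) proj₂

designated-max : ∀ {a b} → Designated (maxᵥ a b) ⇔ (Designated a ⊎ Designated b)
designated-max {𝟘}     = mk⇔ inj₂ [ ⊥-elim ∘ ¬designated-𝟘 , id ]′
designated-max {½} {𝟘} = mk⇔ inj₁ (λ _ → inj₁ refl)
designated-max {½} {½} = mk⇔ inj₁ (λ _ → inj₁ refl)
designated-max {½} {𝟙} = mk⇔ inj₂ (λ _ → inj₂ refl)
designated-max {𝟙}     = mk⇔ (λ _ → inj₁ (inj₂ refl)) (λ _ → inj₂ refl)

undesignated-max : ∀ {a b} → Undesignated (maxᵥ a b) ⇔ (Undesignated a × Undesignated b)
undesignated-max {𝟘}     = mk⇔ (λ u → inj₁ refl , u) proj₂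
undesignated-max {½} {𝟘} = mk⇔ (λ _ → inj₂ refl , inj₁ refl) (λ _ → inj₂ refl)
undesignated-max {½} {½} = mk⇔ (λ u → u , u) proj₁
undesignated-max {½} {𝟙} = mk⇔ (⊥-elim ∘ ¬undesignated-𝟙)
                                (⊥-elim ∘ ¬undesignated-𝟙 ∘ proj₂)
undesignated-max {𝟙}     = mk⇔ (⊥-elim ∘ ¬undesignated-𝟙)
                                (⊥-elim ∘ ¬undesignated-𝟙 ∘ proj₁)

subst-⇔ : ∀ (Q : TV → Set) {a b} {P : Set} → a ≡ b → Q b ⇔ P → Q a ⇔ P
subst-⇔ Q refl Qb⇔P = Qb⇔P

T-not⇒¬T : ∀ {b} → T (not b) → ¬ T b
T-not⇒¬T {false} _ ()

⊎-zip : ∀ {A B C : Set} → A ⊎ C → B ⊎ C → (A × B) ⊎ C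
⊎-zip (inj₁ a) (inj₁ b) = inj₁ (a , b)
⊎-zip (inj₁ _) (inj₂ c) = inj₂ c
⊎-zip (inj₂ c) _        = inj₂ c

module _ (L : Signature) where
  open Sig L

  ≔-same : ∀ {D : Set} (ρ : Var → D) x d → (ρ [ x ≔ d ]) x ≡ d
  ≔-same ρ x d with x ≟ x
  ... | yes _  = refl
  ... | no x≢x = ⊥-elim (x≢x refl)

  ≔-other : ∀ {D : Set} (ρ : Var → D) x {z} d → x ≢ z → (ρ [ x ≔ d ]) z ≡ ρ z
  ≔-other ρ x {z} d x≢z with x ≟ z
  ... | yes x≡z = ⊥-elim (x≢z x≡z)
  ... | no _    = refl

  ≔-cong : ∀ {D : Set} (ρ ρ' : Var → D) y d z → (y ≢ z → ρ z ≡ ρ' z) →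
           (ρ [ y ≔ d ]) z ≡ (ρ' [ y ≔ d ]) z
  ≔-cong ρ ρ' y d z h with y ≟ z
  ... | yes _  = refl
  ... | no y≢z = h y≢z

  ≔-comm : ∀ {D : Set} (ρ : Var → D) {x y} d e z → x ≢ y →
           ((ρ [ y ≔ d ]) [ x ≔ e ]) z ≡ ((ρ [ x ≔ e ]) [ y ≔ d ]) z
  ≔-comm ρ {x} {y} d e z x≢y with x ≟ z
  ... | yes refl = sym (trans (≔-other (ρ [ x ≔ e ]) y d (x≢y ∘ sym)) (≔-same ρ x e))
  ... | no x≢z   = ≔-cong ρ (ρ [ x ≔ e ]) y d z (λ _ → sym (≔-other ρ x e x≢z))

  occursT-var : ∀ {C : Set} z → T (occursT {C} z (var z))
  occursT-var z with z ≟ z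
  ... | yes _  = _
  ... | no z≢z = z≢z refl

  module _ {C : Set} where
    freeIn-∀ : ∀ {z y} (φ : Formula C) → y ≢ z → T (freeIn z φ) → T (freeIn z (∀' y φ))
    freeIn-∀ {z} {y} φ y≢z z∈φ with z ≟ y
    ... | yes z≡y = y≢z (sym z≡y)
    ... | no _    = z∈φ

    freeIn-∃ : ∀ {z y} (φ : Formula C) → y ≢ z → T (freeIn z φ) → T (freeIn z (∃' y φ))
    freeIn-∃ {z} {y} φ y≢z z∈φ with z ≟ y
    ... | yes z≡y = y≢z (sym z≡y)
    ... | no _    = z∈φ

    ¬freeIn-∀ : ∀ {z} y (φ : Formula C) → ¬ T (freeIn z φ) → ¬ T (freeIn z (∀' y φ))
    ¬freeIn-∀ {z} y φ z∉φ with z ≟ y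
    ... | yes _ = λ ()
    ... | no _  = z∉φ

    ¬freeIn-∃ : ∀ {z} y (φ : Formula C) → ¬ T (freeIn z φ) → ¬ T (freeIn z (∃' y φ))
    ¬freeIn-∃ {z} y φ z∉φ with z ≟ y
    ... | yes _ = λ ()
    ... | no _  = z∉φ

    ¬freeIn-∀-bound : ∀ y (φ : Formula C) → ¬ T (freeIn y (∀' y φ))
    ¬freeIn-∀-bound y φ with y ≟ y
    ... | yes _  = λ ()
    ... | no y≢y = ⊥-elim (y≢y refl)

    ¬freeIn-∃-bound : ∀ y (φ : Formula C) → ¬ T (freeIn y (∃' y φ))
    ¬freeIn-∃-bound y φ with y ≟ y
    ... | yes _  = λ ()
    ... | no y≢y = ⊥-elim (y≢y refl)

    mutual
      substT-notOccurs : ∀ x (t s : Term C) → ¬ T (occursT x s) → substT x t s ≡ s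
      substT-notOccurs x t (var y) x∉s with x ≟ y
      ... | yes _ = ⊥-elim (x∉s _)
      ... | no _  = refl
      substT-notOccurs x t (con c)    x∉s = refl
      substT-notOccurs x t (app f ts) x∉s = cong (app f) (substTs-notOccurs x t ts x∉s)

      substTs-notOccurs : ∀ {n} x (t : Term C) (ts : Vec (Term C) n) →
                          ¬ T (occursTs x ts) → substTs x t ts ≡ ts
      substTs-notOccurs x t []       x∉ts = refl
      substTs-notOccurs x t (s ∷ ss) x∉ts =
        cong₂ _∷_ (substT-notOccurs x t s (x∉ts ∘ from T-∨ ∘ inj₁))
                  (substTs-notOccurs x t ss (x∉ts ∘ from T-∨ ∘ inj₂))

    subst-notFree : ∀ (φ : Formula C) x t → ¬ T (freeIn x φ) → φ [ x ↦ t ] ≡ φ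
    subst-notFree (atom P ts) x t x∉φ = cong (atom P) (substTs-notOccurs x t ts x∉φ)
    subst-notFree (¬' φ)      x t x∉φ = cong ¬' (subst-notFree φ x t x∉φ)
    subst-notFree (φ ∧' ψ)    x t x∉φ =
      cong₂ _∧'_ (subst-notFree φ x t (x∉φ ∘ from T-∨ ∘ inj₁))
                 (subst-notFree ψ x t (x∉φ ∘ from T-∨ ∘ inj₂))
    subst-notFree (φ ∨' ψ)    x t x∉φ =
      cong₂ _∨'_ (subst-notFree φ x t (x∉φ ∘ from T-∨ ∘ inj₁))
                 (subst-notFree ψ x t (x∉φ ∘ from T-∨ ∘ inj₂))
    subst-notFree (∀' y φ)    x t x∉φ with x ≟ y
    ... | yes _ = refl
    ... | no _  = cong (∀' y) (subst-notFree φ x t x∉φ)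
    subst-notFree (∃' y φ)    x t x∉φ with x ≟ y
    ... | yes _ = refl
    ... | no _  = cong (∃' y) (subst-notFree φ x t x∉φ)

  module TermSemantics {C D : Set} (M : Structure C D) where
    open Structure M

    mutual
      evalT-coinc : ∀ (ρ ρ' : Var → D) (t : Term C) →
                    (∀ z → T (occursT z t) → ρ z ≡ ρ' z) → evalT M ρ t ≡ evalT M ρ' t
      evalT-coinc ρ ρ' (var y)    h = h y (occursT-var {C} y)
      evalT-coinc ρ ρ' (con c)    h = refl
      evalT-coinc ρ ρ' (app f ts) h = cong (funI f) (evalTs-coinc ρ ρ' ts h)

      evalTs-coinc : ∀ {n} (ρ ρ' : Var → D) (ts : Vec (Term C) n) →
                     (∀ z → T (occursTs z ts) → ρ z ≡ ρ' z) → evalTs M ρ ts ≡ evalTs M ρ' ts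
      evalTs-coinc ρ ρ' []       h = refl
      evalTs-coinc ρ ρ' (t ∷ ts) h =
        cong₂ _∷_ (evalT-coinc ρ ρ' t (λ z → h z ∘ from T-∨ ∘ inj₁))
                  (evalTs-coinc ρ ρ' ts (λ z → h z ∘ from T-∨ ∘ inj₂))

    evalT-≔-notOccurs : ∀ (ρ : Var → D) y d t → ¬ T (occursT y t) →
                        evalT M (ρ [ y ≔ d ]) t ≡ evalT M ρ t
    evalT-≔-notOccurs ρ y d t y∉t = evalT-coinc _ _ t
      (λ z z∈t → ≔-other ρ y d (λ { refl → y∉t z∈t }))

    mutual
      evalT-subst : ∀ (ρ : Var → D) x t (s : Term C) →
                    evalT M ρ (substT x t s) ≡ evalT M (ρ [ x ≔ evalT M ρ t ]) s
      evalT-subst ρ x t (var y) with x ≟ y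
      ... | yes _ = refl
      ... | no _  = refl
      evalT-subst ρ x t (con c)    = refl
      evalT-subst ρ x t (app f ts) = cong (funI f) (evalTs-subst ρ x t ts)

      evalTs-subst : ∀ {n} (ρ : Var → D) x t (ts : Vec (Term C) n) →
                     evalTs M ρ (substTs x t ts) ≡ evalTs M (ρ [ x ≔ evalT M ρ t ]) ts
      evalTs-subst ρ x t []       = refl
      evalTs-subst ρ x t (s ∷ ss) = cong₂ _∷_ (evalT-subst ρ x t s) (evalTs-subst ρ x t ss)

  module Semantics {C D : Set} (I : Interp C D) where
    open Interp I hiding (value)
    open Structure str
    open TermSemantics str

    ∀-cong : ∀ (ρ ρ' : Var → D) y (φ ψ : Formula C) →
             (∀ d → val (ρ [ y ≔ d ]) φ ≡ val (ρ' [ y ≔ d ]) ψ) →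
             val ρ (∀' y φ) ≡ val ρ' (∀' y ψ)
    ∀-cong ρ ρ' y φ ψ h with val-∀-at ρ y φ | val-∀-at ρ' y ψ
    ... | d , φ-at-d | e , ψ-at-e = ≤ᵥ-antisym
      (subst (val ρ (∀' y φ) ≤ᵥ_) (trans (h e) ψ-at-e) (val-∀-lb ρ y φ e))
      (subst (val ρ' (∀' y ψ) ≤ᵥ_) (trans (sym (h d)) φ-at-d) (val-∀-lb ρ' y ψ d))

    ∃-cong : ∀ (ρ ρ' : Var → D) y (φ ψ : Formula C) →
             (∀ d → val (ρ [ y ≔ d ]) φ ≡ val (ρ' [ y ≔ d ]) ψ) →
             val ρ (∃' y φ) ≡ val ρ' (∃' y ψ)
    ∃-cong ρ ρ' y φ ψ h with val-∃-at ρ y φ | val-∃-at ρ' y ψ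
    ... | d , φ-at-d | e , ψ-at-e = ≤ᵥ-antisym
      (subst (_≤ᵥ val ρ' (∃' y ψ)) (trans (sym (h d)) φ-at-d) (val-∃-ub ρ' y ψ d))
      (subst (_≤ᵥ val ρ (∃' y φ)) (trans (h e) ψ-at-e) (val-∃-ub ρ y φ e))

    val-coinc : ∀ (φ : Formula C) (ρ ρ' : Var → D) →
                (∀ z → T (freeIn z φ) → ρ z ≡ ρ' z) → val ρ φ ≡ val ρ' φ
    val-coinc (atom P ts) ρ ρ' h = begin
      val ρ (atom P ts)          ≡⟨ val-atom ρ P ts ⟩
      relI P (evalTs str ρ ts)   ≡⟨ cong (relI P) (evalTs-coinc ρ ρ' ts h) ⟩
      relI P (evalTs str ρ' ts)  ≡⟨ val-atom ρ' P ts ⟨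
      val ρ' (atom P ts)         ∎
      where open ≡-Reasoning
    val-coinc (¬' φ) ρ ρ' h =
      trans (val-¬ ρ φ) (trans (cong neg (val-coinc φ ρ ρ' h)) (sym (val-¬ ρ' φ)))
    val-coinc (φ ∧' ψ) ρ ρ' h =
      trans (val-∧ ρ φ ψ)
            (trans (cong₂ minᵥ (val-coinc φ ρ ρ' (λ z → h z ∘ from T-∨ ∘ inj₁))
                               (val-coinc ψ ρ ρ' (λ z → h z ∘ from T-∨ ∘ inj₂)))
                   (sym (val-∧ ρ' φ ψ)))
    val-coinc (φ ∨' ψ) ρ ρ' h =
      trans (val-∨ ρ φ ψ)
            (trans (cong₂ maxᵥ (val-coinc φ ρ ρ' (λ z → h z ∘ from T-∨ ∘ inj₁))
                               (val-coinc ψ ρ ρ' (λ z → h z ∘ from T-∨ ∘ inj₂)))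
                   (sym (val-∨ ρ' φ ψ)))
    val-coinc (∀' y φ) ρ ρ' h = ∀-cong ρ ρ' y φ φ λ d → val-coinc φ _ _
      (λ z z∈φ → ≔-cong ρ ρ' y d z (λ y≢z → h z (freeIn-∀ φ y≢z z∈φ)))
    val-coinc (∃' y φ) ρ ρ' h = ∃-cong ρ ρ' y φ φ λ d → val-coinc φ _ _
      (λ z z∈φ → ≔-cong ρ ρ' y d z (λ y≢z → h z (freeIn-∃ φ y≢z z∈φ)))

    val-≔-notFree : ∀ (φ : Formula C) (ρ : Var → D) x d → ¬ T (freeIn x φ) →
                    val (ρ [ x ≔ d ]) φ ≡ val ρ φ
    val-≔-notFree φ ρ x d x∉φ =
      val-coinc φ _ _ (λ z z∈φ → ≔-other ρ x d (λ { refl → x∉φ z∈φ }))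

    SubstitutionLemma : Formula C → Var → Term C → Set
    SubstitutionLemma φ x t = ∀ ρ → val ρ (φ [ x ↦ t ]) ≡ val (ρ [ x ≔ evalT str ρ t ]) φ

    substitutionLemma-binder : ∀ (φ : Formula C) {x y} t (ρ : Var → D) → x ≢ y →
      ¬ T (occursT y t) → SubstitutionLemma φ x t →
      ∀ d → val (ρ [ y ≔ d ]) (φ [ x ↦ t ]) ≡ val ((ρ [ x ≔ evalT str ρ t ]) [ y ≔ d ]) φ
    substitutionLemma-binder φ {x} {y} t ρ x≢y y∉t ih d =
      trans (ih (ρ [ y ≔ d ])) (val-coinc φ _ _ λ z _ →
        trans (cong (λ e → ((ρ [ y ≔ d ]) [ x ≔ e ]) z) (evalT-≔-notOccurs ρ y d t y∉t))
              (≔-comm ρ d _ z x≢y))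

    substitutionLemma : ∀ (φ : Formula C) x t → FreeFor t x φ → SubstitutionLemma φ x t
    substitutionLemma (atom P ts) x t _ ρ =
      trans (val-atom ρ P _)
            (trans (cong (relI P) (evalTs-subst ρ x t ts)) (sym (val-atom _ P ts)))
    substitutionLemma (¬' φ) x t ff ρ =
      trans (val-¬ ρ _) (trans (cong neg (substitutionLemma φ x t ff ρ)) (sym (val-¬ _ φ)))
    substitutionLemma (φ ∧' ψ) x t (ffφ , ffψ) ρ =
      trans (val-∧ ρ _ _)
            (trans (cong₂ minᵥ (substitutionLemma φ x t ffφ ρ) (substitutionLemma ψ x t ffψ ρ))
                   (sym (val-∧ _ φ ψ)))
    substitutionLemma (φ ∨' ψ) x t (ffφ , ffψ) ρ =
      trans (val-∨ ρ _ _)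
            (trans (cong₂ maxᵥ (substitutionLemma φ x t ffφ ρ) (substitutionLemma ψ x t ffψ ρ))
                   (sym (val-∨ _ φ ψ)))
    substitutionLemma (∀' y φ) x t ff ρ with x ≟ y | ff
    ... | yes refl | _ = sym (val-≔-notFree (∀' x φ) ρ x _ (¬freeIn-∀-bound x φ))
    ... | no _ | inj₁ x∉φ =
      trans (cong (λ ψ → val ρ (∀' y ψ)) (subst-notFree φ x t (T-not⇒¬T x∉φ)))
            (sym (val-≔-notFree (∀' y φ) ρ x _ (¬freeIn-∀ y φ (T-not⇒¬T x∉φ))))
    ... | no x≢y | inj₂ (y∉t , ffφ) = ∀-cong _ _ y _ φ
      (substitutionLemma-binder φ t ρ x≢y (T-not⇒¬T y∉t) (substitutionLemma φ x t ffφ))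
    substitutionLemma (∃' y φ) x t ff ρ with x ≟ y | ff
    ... | yes refl | _ = sym (val-≔-notFree (∃' x φ) ρ x _ (¬freeIn-∃-bound x φ))
    ... | no _ | inj₁ x∉φ =
      trans (cong (λ ψ → val ρ (∃' y ψ)) (subst-notFree φ x t (T-not⇒¬T x∉φ)))
            (sym (val-≔-notFree (∃' y φ) ρ x _ (¬freeIn-∃ y φ (T-not⇒¬T x∉φ))))
    ... | no x≢y | inj₂ (y∉t , ffφ) = ∃-cong _ _ y _ φ
      (substitutionLemma-binder φ t ρ x≢y (T-not⇒¬T y∉t) (substitutionLemma φ x t ffφ))

    undesignated-¬ : ∀ φ → Undesignated (value I (¬' φ)) ⇔ Designated (value I φ)
    undesignated-¬ φ = subst-⇔ Undesignated (val-¬ asg φ) undesignated-neg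

    designated-¬ : ∀ φ → Designated (value I (¬' φ)) ⇔ Undesignated (value I φ)
    designated-¬ φ = subst-⇔ Designated (val-¬ asg φ) designated-neg

    undesignated-∧ : ∀ φ ψ → Undesignated (value I (φ ∧' ψ)) ⇔
                             (Undesignated (value I φ) ⊎ Undesignated (value I ψ))
    undesignated-∧ φ ψ = subst-⇔ Undesignated (val-∧ asg φ ψ) undesignated-min

    designated-∧ : ∀ φ ψ → Designated (value I (φ ∧' ψ)) ⇔
                           (Designated (value I φ) × Designated (value I ψ))
    designated-∧ φ ψ = subst-⇔ Designated (val-∧ asg φ ψ) designated-min

    undesignated-∨ : ∀ φ ψ → Undesignated (value I (φ ∨' ψ)) ⇔
                             (Undesignated (value I φ) × Undesignated (value I ψ))
    undesignated-∨ φ ψ = subst-⇔ Undesignated (val-∨ asg φ ψ) undesignated-max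

    designated-∨ : ∀ φ ψ → Designated (value I (φ ∨' ψ)) ⇔
                           (Designated (value I φ) ⊎ Designated (value I ψ))
    designated-∨ φ ψ = subst-⇔ Designated (val-∨ asg φ ψ) designated-max

  module Satisfaction {D : Set} (I : Interp Wit D) where
    private
      U Dg : HFormula → Set
      U φ = Undesignated (value I φ)
      Dg φ = Designated (value I φ)

    STSat-∷ˡ : ∀ {φ Γ Δ} → STSat I (φ ∷ Γ , Δ) ⇔ (U φ ⊎ STSat I (Γ , Δ))
    STSat-∷ˡ {φ} {Γ} {Δ} = mk⇔ uncons cons
      where
      uncons : STSat I (φ ∷ Γ , Δ) → U φ ⊎ STSat I (Γ , Δ)
      uncons (inj₁ (here u))  = inj₁ u
      uncons (inj₁ (there γ)) = inj₂ (inj₁ γ)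
      uncons (inj₂ δ)         = inj₂ (inj₂ δ)
      cons : U φ ⊎ STSat I (Γ , Δ) → STSat I (φ ∷ Γ , Δ)
      cons (inj₁ u)        = inj₁ (here u)
      cons (inj₂ (inj₁ γ)) = inj₁ (there γ)
      cons (inj₂ (inj₂ δ)) = inj₂ δ

    STSat-∷ʳ : ∀ {φ Γ Δ} → STSat I (Γ , φ ∷ Δ) ⇔ (Dg φ ⊎ STSat I (Γ , Δ))
    STSat-∷ʳ {φ} {Γ} {Δ} = mk⇔ uncons cons
      where
      uncons : STSat I (Γ , φ ∷ Δ) → Dg φ ⊎ STSat I (Γ , Δ)
      uncons (inj₂ (here d))  = inj₁ d
      uncons (inj₂ (there δ)) = inj₂ (inj₂ δ)
      uncons (inj₁ γ)         = inj₂ (inj₁ γ)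
      cons : Dg φ ⊎ STSat I (Γ , Δ) → STSat I (Γ , φ ∷ Δ)
      cons (inj₁ d)        = inj₂ (here d)
      cons (inj₂ (inj₂ δ)) = inj₂ (there δ)
      cons (inj₂ (inj₁ γ)) = inj₁ γ

    STSat-ax : ∀ φ → STSat I (φ ∷ [] , φ ∷ [])
    STSat-ax φ = [ inj₁ ∘ here , inj₂ ∘ here ]′ (undesignated⊎designated (value I φ))

    STSat-resp-≈ˢ : ∀ {Γ Δ Γ' Δ'} → Γ ≈ˢ Γ' → Δ ≈ˢ Δ' → STSat I (Γ , Δ) → STSat I (Γ' , Δ')
    STSat-resp-≈ˢ (Γ⊆Γ' , _) (Δ⊆Δ' , _) = Sum.map (Any-resp-⊆ Γ⊆Γ') (Any-resp-⊆ Δ⊆Δ')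

    module _ {Γ Δ : List HFormula} where
      weakenˡ : ∀ {φ} → STSat I (Γ , Δ) → STSat I (φ ∷ Γ , Δ)
      weakenˡ = from STSat-∷ˡ ∘ inj₂

      weakenʳ : ∀ {φ} → STSat I (Γ , Δ) → STSat I (Γ , φ ∷ Δ)
      weakenʳ = from STSat-∷ʳ ∘ inj₂

      replaceˡ : ∀ {φ ψ} → (U φ → U ψ) → STSat I (φ ∷ Γ , Δ) → STSat I (ψ ∷ Γ , Δ)
      replaceˡ f = from STSat-∷ˡ ∘ map₁ f ∘ to STSat-∷ˡ

      replaceʳ : ∀ {φ ψ} → (Dg φ → Dg ψ) → STSat I (Γ , φ ∷ Δ) → STSat I (Γ , ψ ∷ Δ)
      replaceʳ f = from STSat-∷ʳ ∘ map₁ f ∘ to STSat-∷ʳ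

      moveˡʳ : ∀ {φ ψ} → (U φ → Dg ψ) → STSat I (φ ∷ Γ , Δ) → STSat I (Γ , ψ ∷ Δ)
      moveˡʳ f = from STSat-∷ʳ ∘ map₁ f ∘ to STSat-∷ˡ

      moveʳˡ : ∀ {φ ψ} → (Dg φ → U ψ) → STSat I (Γ , φ ∷ Δ) → STSat I (ψ ∷ Γ , Δ)
      moveʳˡ f = from STSat-∷ˡ ∘ map₁ f ∘ to STSat-∷ʳ

      mergeˡ : ∀ {φ ψ χ} → (U φ ⊎ U ψ → U χ) → STSat I (φ ∷ ψ ∷ Γ , Δ) → STSat I (χ ∷ Γ , Δ)
      mergeˡ f = from STSat-∷ˡ ∘ map₁ f ∘ assocˡ ∘ map₂ (to STSat-∷ˡ) ∘ to STSat-∷ˡ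

      mergeʳ : ∀ {φ ψ χ} → (Dg φ ⊎ Dg ψ → Dg χ) → STSat I (Γ , φ ∷ ψ ∷ Δ) → STSat I (Γ , χ ∷ Δ)
      mergeʳ f = from STSat-∷ʳ ∘ map₁ f ∘ assocˡ ∘ map₂ (to STSat-∷ʳ) ∘ to STSat-∷ʳ

      splitˡ : ∀ {φ ψ χ} → (U χ → U φ ⊎ U ψ) → STSat I (χ ∷ Γ , Δ) → STSat I (φ ∷ ψ ∷ Γ , Δ)
      splitˡ f = from STSat-∷ˡ ∘ map₂ (from STSat-∷ˡ) ∘ assocʳ ∘ map₁ f ∘ to STSat-∷ˡ

      splitʳ : ∀ {φ ψ χ} → (Dg χ → Dg φ ⊎ Dg ψ) → STSat I (Γ , χ ∷ Δ) → STSat I (Γ , φ ∷ ψ ∷ Δ)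
      splitʳ f = from STSat-∷ʳ ∘ map₂ (from STSat-∷ʳ) ∘ assocʳ ∘ map₁ f ∘ to STSat-∷ʳ

      zipˡ : ∀ {φ ψ χ} → (U φ × U ψ → U χ) →
             STSat I (φ ∷ Γ , Δ) → STSat I (ψ ∷ Γ , Δ) → STSat I (χ ∷ Γ , Δ)
      zipˡ f p q = from STSat-∷ˡ (map₁ f (⊎-zip (to STSat-∷ˡ p) (to STSat-∷ˡ q)))

      zipʳ : ∀ {φ ψ χ} → (Dg φ × Dg ψ → Dg χ) →
             STSat I (Γ , φ ∷ Δ) → STSat I (Γ , ψ ∷ Δ) → STSat I (Γ , χ ∷ Δ)
      zipʳ f p q = from STSat-∷ʳ (map₁ f (⊎-zip (to STSat-∷ʳ p) (to STSat-∷ʳ q)))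

  module Soundness (X : Sequent → Set) {D : Set} (M : HenkinModel D)
                   (⊨X : ∀ s → X s → STSat (HenkinModel.hen M) s) where
    open HenkinModel M
    open Interp hen using (asg; val-∀-lb; val-∃-ub)
    open Semantics hen
    open Satisfaction hen

    w∀-least : ∀ x φ t → FreeFor t x φ →
               value hen (φ [ x ↦ w∀ x φ ]) ≤ᵥ value hen (φ [ x ↦ t ])
    w∀-least x φ t ff = subst₂ _≤ᵥ_ (sym (witAll x φ)) (sym (substitutionLemma φ x t ff asg))
                                   (val-∀-lb asg x φ _)

    w∃-greatest : ∀ x φ t → FreeFor t x φ →
                  value hen (φ [ x ↦ t ]) ≤ᵥ value hen (φ [ x ↦ w∃ x φ ])
    w∃-greatest x φ t ff = subst₂ _≤ᵥ_ (sym (substitutionLemma φ x t ff asg)) (sym (witEx x φ))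
                                      (val-∃-ub asg x φ _)

    sound : ∀ {S} → X ⊢STH S → STSat hen S
    sound (hyp Xs)               = ⊨X _ Xs
    sound (ax {φ})               = STSat-ax φ
    sound (sets Γ≈Γ' Δ≈Δ' p)     = STSat-resp-≈ˢ Γ≈Γ' Δ≈Δ' (sound p)
    sound (WL p)                 = weakenˡ (sound p)
    sound (WR p)                 = weakenʳ (sound p)
    sound (∧L↓ {φ} {ψ} p)        = mergeˡ (from (undesignated-∧ φ ψ)) (sound p)
    sound (∧L↑ {φ} {ψ} p)        = splitˡ (to (undesignated-∧ φ ψ)) (sound p)
    sound (∧R↓ {φ} {ψ} p q)      = zipʳ (from (designated-∧ φ ψ)) (sound p) (sound q)
    sound (∧R↑₁ {φ} {ψ} p)       = replaceʳ (proj₁ ∘ to (designated-∧ φ ψ)) (sound p)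
    sound (∧R↑₂ {φ} {ψ} p)       = replaceʳ (proj₂ ∘ to (designated-∧ φ ψ)) (sound p)
    sound (∨L↓ {φ} {ψ} p q)      = zipˡ (from (undesignated-∨ φ ψ)) (sound p) (sound q)
    sound (∨L↑₁ {φ} {ψ} p)       = replaceˡ (proj₁ ∘ to (undesignated-∨ φ ψ)) (sound p)
    sound (∨L↑₂ {φ} {ψ} p)       = replaceˡ (proj₂ ∘ to (undesignated-∨ φ ψ)) (sound p)
    sound (∨R↓ {φ} {ψ} p)        = mergeʳ (from (designated-∨ φ ψ)) (sound p)
    sound (∨R↑ {φ} {ψ} p)        = splitʳ (to (designated-∨ φ ψ)) (sound p)
    sound (¬R↓ {φ} p)            = moveˡʳ (from (designated-¬ φ)) (sound p)
    sound (¬R↑ {φ} p)            = moveʳˡ (to (designated-¬ φ)) (sound p)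
    sound (¬L↓ {φ} p)            = moveʳˡ (from (undesignated-¬ φ)) (sound p)
    sound (¬L↑ {φ} p)            = moveˡʳ (to (undesignated-¬ φ)) (sound p)
    sound (∀LW↓ {x} {φ} p)       = replaceˡ (subst Undesignated (witAll x φ)) (sound p)
    sound (∀LW↑ {x} {φ} p)       = replaceˡ (subst Undesignated (sym (witAll x φ))) (sound p)
    sound (∀RW↓ {x} {φ} p)       = replaceʳ (subst Designated (witAll x φ)) (sound p)
    sound (∀RW↑ {x} {φ} p)       = replaceʳ (subst Designated (sym (witAll x φ))) (sound p)
    sound (∃LW↓ {x} {φ} p)       = replaceˡ (subst Undesignated (witEx x φ)) (sound p)
    sound (∃LW↑ {x} {φ} p)       = replaceˡ (subst Undesignated (sym (witEx x φ))) (sound p)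
    sound (∃RW↓ {x} {φ} p)       = replaceʳ (subst Designated (witEx x φ)) (sound p)
    sound (∃RW↑ {x} {φ} p)       = replaceʳ (subst Designated (sym (witEx x φ))) (sound p)
    sound (UWI {x} {φ} {t} ff p) = replaceˡ (undesignated-antimono (w∀-least x φ t ff)) (sound p)
    sound (EWI {x} {φ} {t} ff p) = replaceʳ (designated-mono (w∃-greatest x φ t ff)) (sound p)
    sound (EWE {x} {φ} {t} ff p) = replaceˡ (undesignated-antimono (w∃-greatest x φ t ff)) (sound p)
    sound (UWE {x} {φ} {t} ff p) = replaceʳ (designated-mono (w∀-least x φ t ff)) (sound p)

mainTheorem1 : (L : Signature) (X : Sig.Sequent L → Set) (S : Sig.Sequent L) →
               (∀ s → X s → Sig.IsLSequent L s) → Sig.IsLSequent L S →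
               Sig._⊢STH_ L X S → Sig._⊨STH_ L X S
mainTheorem1 L X S _ _ ⊢S D _ M ⊨X = Soundness.sound L X M ⊨X ⊢S
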